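{- Let $\mathcal{L}$ be the category whose objects are natural numbers and whose morphisms $m\to n$ are the total injective increasing functions $[m]\to[n]$, let $\mathcal{G}$ be its full subcategory on the objects $1$ and $2$, $I:\mathcal{G}\to\mathcal{L}$ the inclusion, and $N_I:\mathcal{L}\to\hat{\mathcal{G}}$ the nerve $N_I(n)=\mathcal{L}(I-,n)$. Given a graph $G\in\hat{\mathcal{G}}$, the diagram $I\circ\pi_G:\mathrm{El}(G)\to\mathcal{L}$ admits a colimit in $\mathcal{L}$ if and only if there exist $n\in\mathbb{N}$ and a morphism $f:G\to N_I(n)$ in $\hat{\mathcal{G}}$ such that for every $m\in\mathbb{N}$ and every morphism $g:G\to N_I(m)$ in $\hat{\mathcal{G}}$ there is a unique morphism $h:N_I(n)\to N_I(m)$ with $h\circ f=g$.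
   Context: For $n\in\mathbb{N}$ write $[n]=\{0,\dots,n-1\}$; $s^n_i:n\to n+1$ is the increasing injection with image $[n+1]\setminus\{i\}$. The only non-identity morphisms of $\mathcal{G}$ are $s^1_0,s^1_1:1\to2$, so $G\in\hat{\mathcal{G}}$ is a graph with vertices $G(1)$, edges $G(2)$, source $G(s^1_1)$ and target $G(s^1_0)$, and morphisms in $\hat{\mathcal{G}}$ are graph morphisms. Concretely $N_I(n)$ is the graph with vertex set $[n]$ and exactly one edge $i\to j$ for each $i<j$. $\mathrm{El}(G)$ has objects $(k,x)$ with $k\in\{1,2\}$, $x\in G(k)$, and morphisms $(k,x)\to(k',x')$ the morphisms $u:k\to k'$ of $\mathcal{G}$ with $G(u)(x')=x$; $\pi_G$ is the first projection. -}

module Defs where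

open import Data.Nat as ℕ using (ℕ; zero; suc; z≤n; s≤s)
open import Data.Fin using (Fin; zero; suc; punchIn; _<_)
open import Data.Product using (Σ; Σ-syntax; ∃; ∃-syntax; _×_; _,_)
open import Relation.Binary.PropositionalEquality using (_≡_; refl)
open import Relation.Binary.Bundles using (Setoid)
open import Function.Bundles using (Func)
open import Level using (0ℓ)

-- The category 𝓛 : objects ℕ (n stands for [n] = Fin n),
-- morphisms m → n the injective increasing (= strictly increasing)
-- total functions [m] → [n].

record Hom (m n : ℕ) : Set where
  constructor mkHom
  field
    fun  : Fin m → Fin n
    mono : ∀ {i j : Fin m} → i < j → fun i < fun j
open Hom public

_≈L_ : ∀ {m n} → Hom m n → Hom m n → Set
f ≈L g = ∀ i → fun f i ≡ fun g i

idL : ∀ {n} → Hom n n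
idL = mkHom (λ i → i) (λ p → p)

_∘L_ : ∀ {l m n} → Hom m n → Hom l m → Hom l n
g ∘L f = mkHom (λ i → fun g (fun f i)) (λ p → mono g (mono f p))

HomSetoid : ℕ → ℕ → Setoid 0ℓ 0ℓ
HomSetoid m n = record
  { Carrier = Hom m n
  ; _≈_ = _≈L_
  ; isEquivalence = record
    { refl = λ i → refl
    ; sym = λ p i → Relation.Binary.PropositionalEquality.sym (p i)
    ; trans = λ p q i → Relation.Binary.PropositionalEquality.trans (p i) (q i)
    }
  }

punchIn-mono-< : ∀ {n} (i : Fin (suc n)) (j k : Fin n) → j < k → punchIn i j < punchIn i k
punchIn-mono-< zero    j       k       p       = s≤s p
punchIn-mono-< (suc i) zero    (suc k) p       = s≤s z≤n
punchIn-mono-< (suc i) (suc j) (suc k) (s≤s p) = s≤s (punchIn-mono-< i j k p)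

s : (n : ℕ) → Fin (suc n) → Hom n (suc n)
s n i = mkHom (punchIn i) (λ {j} {k} p → punchIn-mono-< i j k p)

data GObj : Set where
  one two : GObj

I₀ : GObj → ℕ
I₀ one = 1
I₀ two = 2

data GHom : GObj → GObj → Set where
  idG : ∀ {k} → GHom k k
  s⁰  : GHom one two
  s¹  : GHom one two

I₁ : ∀ {k k'} → GHom k k' → Hom (I₀ k) (I₀ k')
I₁ idG = idL
I₁ s⁰  = s 1 zero
I₁ s¹  = s 1 (suc zero)

-- Graphs = presheaves on 𝓖 (set-valued).

record Graph : Set₁ where
  field
    V   : Set
    E   : Set
    src : E → V
    tgt : E → V

  G₀ : GObj → Set
  G₀ one = V
  G₀ two = E

  G₁ : ∀ {k k'} → GHom k k' → G₀ k' → G₀ k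
  G₁ idG x = x
  G₁ s⁰  e = tgt e
  G₁ s¹  e = src e
open Graph public

module _ (G : Graph) where

  ElObj : Set
  ElObj = Σ[ k ∈ GObj ] G₀ G k

  ElHom : ElObj → ElObj → Set
  ElHom (k , x) (k' , x') = Σ[ u ∈ GHom k k' ] (G₁ G u x' ≡ x)

  π₀ : ElObj → GObj
  π₀ (k , _) = k

  π₁ : ∀ {a b} → ElHom a b → GHom (π₀ a) (π₀ b)
  π₁ (u , _) = u

  record Cocone (c : ℕ) : Set where
    constructor mkCocone
    field
      ι   : (a : ElObj) → Hom (I₀ (π₀ a)) c
      nat : ∀ (a b : ElObj) (φ : ElHom a b) → (ι b ∘L I₁ (π₁ {a} {b} φ)) ≈L ι a
  open Cocone public

  IsColimit : (c : ℕ) → Cocone c → Set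
  IsColimit c λc =
    ∀ (c' : ℕ) (μ : Cocone c') →
      Σ[ h ∈ Hom c c' ]
        ((∀ a → (h ∘L ι λc a) ≈L ι μ a)
        × (∀ (h' : Hom c c') → (∀ a → (h' ∘L ι λc a) ≈L ι μ a) → h' ≈L h))

  HasColimit : Set
  HasColimit = Σ[ c ∈ ℕ ] Σ[ λc ∈ Cocone c ] IsColimit c λc

-- Setoid-valued graphs (needed because the hom-sets of 𝓛 carry
-- extensional equality ≈L), their morphisms, composition and equality.

record SGraph : Set₁ where
  field
    SV   : Setoid 0ℓ 0ℓ
    SE   : Setoid 0ℓ 0ℓ
    ssrc : Func SE SV
    stgt : Func SE SV
open SGraph public

module _ where
  open Setoid using (Carrier)
  open Func using (to)

  record GMor (A B : SGraph) : Set where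
    constructor mkGMor
    field
      onV : Func (SV A) (SV B)
      onE : Func (SE A) (SE B)
      src-comm : ∀ (e : Carrier (SE A)) →
        Setoid._≈_ (SV B) (to (ssrc B) (to onE e)) (to onV (to (ssrc A) e))
      tgt-comm : ∀ (e : Carrier (SE A)) →
        Setoid._≈_ (SV B) (to (stgt B) (to onE e)) (to onV (to (stgt A) e))
  open GMor public

  _≈G_ : ∀ {A B} → GMor A B → GMor A B → Set
  _≈G_ {A} {B} f g =
    (∀ v → Setoid._≈_ (SV B) (to (onV f) v) (to (onV g) v)) ×
    (∀ e → Setoid._≈_ (SE B) (to (onE f) e) (to (onE g) e))

  _∘G_ : ∀ {A B C} → GMor B C → GMor A B → GMor A C
  _∘G_ {A} {B} {C} g f = mkGMor
    (record { to = λ v → to (onV g) (to (onV f) v)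
            ; cong = λ p → Func.cong (onV g) (Func.cong (onV f) p) })
    (record { to = λ e → to (onE g) (to (onE f) e)
            ; cong = λ p → Func.cong (onE g) (Func.cong (onE f) p) })
    (λ e → Setoid.trans (SV C) (src-comm g (to (onE f) e)) (Func.cong (onV g) (src-comm f e)))
    (λ e → Setoid.trans (SV C) (tgt-comm g (to (onE f) e)) (Func.cong (onV g) (tgt-comm f e)))

open import Relation.Binary.PropositionalEquality.Properties using (setoid)
import Relation.Binary.PropositionalEquality as Eq

disc : Graph → SGraph
disc G = record
  { SV = setoid (V G) ; SE = setoid (E G)
  ; ssrc = record { to = src G ; cong = Eq.cong (src G) }
  ; stgt = record { to = tgt G ; cong = Eq.cong (tgt G) } }

N : ℕ → SGraph
N n = record
  { SV = HomSetoid 1 n ; SE = HomSetoid 2 n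
  ; ssrc = record { to = λ σ → σ ∘L I₁ s¹ ; cong = λ p i → p (fun (I₁ s¹) i) }
  ; stgt = record { to = λ σ → σ ∘L I₁ s⁰ ; cong = λ p i → p (fun (I₁ s⁰) i) } }

module Submission where

--  * Cocones over I ∘ π_G with apex c are graph morphisms G → N(c): a
--    cocone assigns to each vertex a point of [c] and to each edge a
--    pair of points, naturality saying that source/target are respected
--    ('coconeMor', 'morCocone'); a morphism h : c → m commutes with two
--    cocones iff N(h) commutes with the corresponding graph morphisms
--    ('commutes⇔').
--  * The nerve N_I is fully faithful: every graph morphism H : N(c) → N(m)
--    is determined by its action on the points of [c], which is a
--    morphism 'fromMor H' of 𝓛 with H ≈ N(fromMor H) ('nerve-full').

open import Defs
open import Data.Nat using (ℕ; z≤n; s≤s)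
open import Data.Fin using (Fin; zero; suc; _<_)
open import Data.Product using (Σ; Σ-syntax; _×_; _,_; proj₁; proj₂)
open import Function.Bundles using (_⇔_; mk⇔; Func; Equivalence)
open import Relation.Binary.Bundles using (Setoid)
open import Relation.Binary.PropositionalEquality using (_≡_; refl; trans; cong; subst₂)

open Func using (to)

module _ {A B : SGraph} where
  private
    module V = Setoid (SV B)
    module E = Setoid (SE B)

  ≈G-sym : {f g : GMor A B} → f ≈G g → g ≈G f
  ≈G-sym (pv , pe) = (λ v → V.sym (pv v)) , (λ e → E.sym (pe e))

  ≈G-trans : {f g h : GMor A B} → f ≈G g → g ≈G h → f ≈G h
  ≈G-trans (pv , pe) (qv , qe) =
    (λ v → V.trans (pv v) (qv v)) , (λ e → E.trans (pe e) (qe e))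

∘G-congʳ : ∀ {A B C} {g g' : GMor B C} (f : GMor A B) → g ≈G g' → (g ∘G f) ≈G (g' ∘G f)
∘G-congʳ f (pv , pe) = (λ v → pv (to (onV f) v)) , (λ e → pe (to (onE f) e))

nerveMor : ∀ {c m} → Hom c m → GMor (N c) (N m)
nerveMor h = mkGMor
  (record { to = λ σ → h ∘L σ ; cong = λ p i → cong (fun h) (p i) })
  (record { to = λ τ → h ∘L τ ; cong = λ p i → cong (fun h) (p i) })
  (λ τ i → refl) (λ τ i → refl)

nerveMor-cong : ∀ {c m} {h h' : Hom c m} → h ≈L h' → nerveMor h ≈G nerveMor h'
nerveMor-cong p = (λ σ i → p (fun σ i)) , (λ τ i → p (fun τ i))

pt : ∀ {c} → Fin c → Hom 1 c
pt i = mkHom (λ _ → i) (λ { {zero} {zero} () })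

edge : ∀ {c} (i j : Fin c) → i < j → Hom 2 c
edge {c} i j i<j = mkHom endpoint endpoint-mono
  where
  endpoint : Fin 2 → Fin c
  endpoint zero       = i
  endpoint (suc zero) = j

  endpoint-mono : ∀ {a b : Fin 2} → a < b → endpoint a < endpoint b
  endpoint-mono {zero}     {zero}     ()
  endpoint-mono {zero}     {suc zero} _  = i<j
  endpoint-mono {suc zero} {zero}     ()
  endpoint-mono {suc zero} {suc zero} (s≤s ())

vertexMap : ∀ {c m} → GMor (N c) (N m) → Fin c → Fin m
vertexMap H i = fun (to (onV H) (pt i)) zero

-- A graph morphism between nerves acts on every vertex and on both
-- endpoints of every edge through 'vertexMap': vertices are equal to the
-- point they pick, and edges carry their endpoints along by src/tgt.
vertex-action : ∀ {c m} (H : GMor (N c) (N m)) (σ : Hom 1 c) →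
  fun (to (onV H) σ) zero ≡ vertexMap H (fun σ zero)
vertex-action H σ = Func.cong (onV H) {σ} {pt (fun σ zero)} (λ { zero → refl }) zero

edge-action : ∀ {c m} (H : GMor (N c) (N m)) (τ : Hom 2 c) (i : Fin 2) →
  fun (to (onE H) τ) i ≡ vertexMap H (fun τ i)
edge-action H τ zero =
  trans (src-comm H τ zero) (vertex-action H (τ ∘L I₁ s¹))
edge-action H τ (suc zero) =
  trans (tgt-comm H τ zero) (vertex-action H (τ ∘L I₁ s⁰))

-- 'vertexMap H' is increasing, since H sends the edge i → j to an edge
-- of N(m) whose endpoints are its images.
fromMor : ∀ {c m} → GMor (N c) (N m) → Hom c m
fromMor H = mkHom (vertexMap H) increasing
  where
  increasing : ∀ {i j} → i < j → vertexMap H i < vertexMap H j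
  increasing {i} {j} i<j =
    subst₂ _<_ (edge-action H (edge i j i<j) zero) (edge-action H (edge i j i<j) (suc zero))
      (mono (to (onE H) (edge i j i<j)) {zero} {suc zero} (s≤s z≤n))

fromMor-cong : ∀ {c m} {H H' : GMor (N c) (N m)} → H ≈G H' → fromMor H ≈L fromMor H'
fromMor-cong (pv , _) i = pv (pt i) zero

-- Fullness of the nerve (faithfulness is fromMor (nerveMor h) = h, which
-- holds by definition).
nerve-full : ∀ {c m} (H : GMor (N c) (N m)) → H ≈G nerveMor (fromMor H)
nerve-full H = (λ σ → λ { zero → vertex-action H σ }) , edge-action H

factor-through-nerve : ∀ {A c m} (H : GMor (N c) (N m)) (f : GMor A (N c)) {g : GMor A (N m)} →
  (H ∘G f) ≈G g → (nerveMor (fromMor H) ∘G f) ≈G g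
factor-through-nerve H f {g} =
  ≈G-trans {f = nerveMor (fromMor H) ∘G f} {g = H ∘G f} {h = g}
    (∘G-congʳ {g = nerveMor (fromMor H)} {g' = H} f (≈G-sym {f = H} {g = nerveMor (fromMor H)} (nerve-full H)))

module _ (G : Graph) where

  coconeMor : ∀ {c} → Cocone G c → GMor (disc G) (N c)
  coconeMor μ = mkGMor
    (record { to = λ v → ι μ (one , v) ; cong = λ p i → cong (λ v → fun (ι μ (one , v)) i) p })
    (record { to = λ e → ι μ (two , e) ; cong = λ p i → cong (λ e → fun (ι μ (two , e)) i) p })
    (λ e → nat μ (one , src G e) (two , e) (s¹ , refl))
    (λ e → nat μ (one , tgt G e) (two , e) (s⁰ , refl))

  morCocone : ∀ {c} → GMor (disc G) (N c) → Cocone G c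
  morCocone {c} f = mkCocone leg naturality
    where
    leg : (a : ElObj G) → Hom (I₀ (π₀ G a)) c
    leg (one , v) = to (onV f) v
    leg (two , e) = to (onE f) e

    naturality : ∀ (a b : ElObj G) (φ : ElHom G a b) → (leg b ∘L I₁ (π₁ G {a} {b} φ)) ≈L leg a
    naturality (one , x)         (one , .x) (idG , refl) i = refl
    naturality (two , x)         (two , .x) (idG , refl) i = refl
    naturality (one , .(tgt G e)) (two , e) (s⁰ , refl)   = tgt-comm f e
    naturality (one , .(src G e)) (two , e) (s¹ , refl)   = src-comm f e

  Commutes : ∀ {c m} → Hom c m → Cocone G c → Cocone G m → Set
  Commutes h λc μ = ∀ a → (h ∘L ι λc a) ≈L ι μ a

  commutes⇔ : ∀ {c m} (h : Hom c m) (λc : Cocone G c) (μ : Cocone G m) →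
    Commutes h λc μ ⇔ ((nerveMor h ∘G coconeMor λc) ≈G coconeMor μ)
  commutes⇔ h λc μ = mk⇔
    (λ p → (λ v → p (one , v)) , (λ e → p (two , e)))
    (λ { (pv , pe) (one , v) → pv v ; (pv , pe) (two , e) → pe e })

  Universal : (n : ℕ) → GMor (disc G) (N n) → Set
  Universal n f = (m : ℕ) (g : GMor (disc G) (N m)) →
    Σ[ h ∈ GMor (N n) (N m) ]
      (((h ∘G f) ≈G g) × ((h' : GMor (N n) (N m)) → (h' ∘G f) ≈G g → h' ≈G h))

  -- A colimiting cocone is a universal arrow: the mediating morphism h
  -- gives N(h), and any H factoring g is N(fromMor H) with fromMor H = h.
  colimit⇒universal : ∀ {c} (λc : Cocone G c) → IsColimit G c λc → Universal c (coconeMor λc)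
  colimit⇒universal {c} λc colim m g
    with colim m (morCocone g)
  ... | h , comm , uniq = nerveMor h , Equivalence.to (commutes⇔ h λc μ) comm , unique
    where
    μ : Cocone G m
    μ = morCocone g

    unique : (H : GMor (N c) (N m)) → (H ∘G coconeMor λc) ≈G g → H ≈G nerveMor h
    unique H Hf≈g = ≈G-trans {f = H} {g = nerveMor (fromMor H)} {h = nerveMor h}
      (nerve-full H) (nerveMor-cong {h = fromMor H} {h' = h} (uniq (fromMor H) restriction-commutes))
      where
      restriction-commutes : Commutes (fromMor H) λc μ
      restriction-commutes = Equivalence.from (commutes⇔ (fromMor H) λc μ)
        (factor-through-nerve H (coconeMor λc) {g} Hf≈g)

  -- A universal arrow gives a colimiting cocone: the mediating graph
  -- morphism H gives fromMor H, and any h with N(h) factoring equals it.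
  universal⇒colimit : ∀ {n} (f : GMor (disc G) (N n)) → Universal n f → IsColimit G n (morCocone f)
  universal⇒colimit {n} f univ m μ
    with univ m (coconeMor μ)
  ... | H , comm , uniq = fromMor H , restriction-commutes , unique
    where
    restriction-commutes : Commutes (fromMor H) (morCocone f) μ
    restriction-commutes = Equivalence.from (commutes⇔ (fromMor H) (morCocone f) μ)
      (factor-through-nerve H f {coconeMor μ} comm)

    unique : (h : Hom n m) → Commutes h (morCocone f) μ → h ≈L fromMor H
    unique h hcomm = fromMor-cong {H = nerveMor h} {H' = H}
      (uniq (nerveMor h) (Equivalence.to (commutes⇔ h (morCocone f) μ) hcomm))

lemma12 : (G : Graph) →
    HasColimit G ⇔
    (Σ[ n ∈ ℕ ] Σ[ f ∈ GMor (disc G) (N n) ]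
    ((m : ℕ) (g : GMor (disc G) (N m)) →
    Σ[ h ∈ GMor (N n) (N m) ]
    (((h ∘G f) ≈G g) × ((h' : GMor (N n) (N m)) → (h' ∘G f) ≈G g → h' ≈G h))))
lemma12 G = mk⇔
  (λ (c , λc , colim) → c , coconeMor G λc , colimit⇒universal G λc colim)
  (λ (n , f , univ) → n , morCocone G f , universal⇒colimit G f univ)
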